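{- If positive integers $x\geq y$ satisfy $x\mid y^2-y+1$ and $y\mid x^2-x+1$, then $x=y=1$. -}

module Defs where

{-# OPTIONS --safe #-}
-- Vieta jumping. Write y² − y + 1 = a·x. Then a < y as soon as y > 1, and since
-- a·x ≡ 1 (mod y), multiplying x² − x + 1 ≡ 0 by a² gives a² − a + 1 ≡ 0 (mod y).
-- So (y, a) is again a solution with a smaller second entry; descending, the
-- second entry reaches 1, and y ∣ a² − a + 1 = 1 at that step forces y = 1.
module Submission where

open import Defs
open import Data.Nat using (ℕ; zero; suc; _+_; _*_; _∸_; _≥_; _>_; _≤_; _<_; s≤s; z≤n)
open import Data.Nat.Properties
open import Data.Nat.Divisibility
open import Data.Nat.Induction using (<-rec)
open import Data.Nat.Tactic.RingSolver using (solve)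
open import Data.List using (_∷_; [])
open import Data.Product using (_×_; _,_)
open import Data.Empty using (⊥-elim)
open import Relation.Binary.PropositionalEquality

suc-square∸suc : ∀ m → suc m * suc m ∸ suc m ≡ m * suc m
suc-square∸suc m = m+n∸m≡n (suc m) (m * suc m)

n∣n*n∸n : ∀ n → n ∣ n * n ∸ n
n∣n*n∸n zero    = ∣-refl
n∣n*n∸n (suc m) = subst (suc m ∣_) (sym (suc-square∸suc m)) (n∣m*n m)

-- With t = x² − x and u = a² − a written additively, so that no subtraction occurs.
conjugate-identity : ∀ a x s t u → a * x ≡ s + 1 → t + x ≡ x * x → u + a ≡ a * a →
                     a * a * (t + 1) + a * s ≡ s * s + 2 * s + (u + 1)
conjugate-identity a x s t u ax≡s+1 t+x≡x² u+a≡a² = +-cancelʳ-≡ a _ _ (begin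
  a * a * (t + 1) + a * s + a      ≡⟨ solve (a ∷ s ∷ t ∷ []) ⟩
  a * a * (t + 1) + a * (s + 1)    ≡⟨ cong (λ p → a * a * (t + 1) + a * p) (sym ax≡s+1) ⟩
  a * a * (t + 1) + a * (a * x)    ≡⟨ solve (a ∷ x ∷ t ∷ []) ⟩
  a * a * ((t + x) + 1)            ≡⟨ cong (λ p → a * a * (p + 1)) t+x≡x² ⟩
  a * a * (x * x + 1)              ≡⟨ solve (a ∷ x ∷ []) ⟩
  (a * x) * (a * x) + a * a        ≡⟨ cong₂ (λ p q → p * p + q) ax≡s+1 (sym u+a≡a²) ⟩
  (s + 1) * (s + 1) + (u + a)      ≡⟨ solve (a ∷ s ∷ u ∷ []) ⟩
  s * s + 2 * s + (u + 1) + a      ∎)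
  where open ≡-Reasoning

conjugate-divides : ∀ {a x y} → y ∣ x * x ∸ x + 1 → a * x ≡ y * y ∸ y + 1 → y ∣ a * a ∸ a + 1
conjugate-divides {zero}          _ 0≡s+1 = ⊥-elim (0≢1+n (trans 0≡s+1 (+-comm _ 1)))
conjugate-divides {suc j} {zero}  _ ax≡s+1 =
  ⊥-elim (0≢1+n (trans (sym (*-zeroʳ j)) (trans ax≡s+1 (+-comm _ 1))))
conjugate-divides {a@(suc j)} {x@(suc i)} {y} y∣x²-x+1 ax≡s+1 =
  subst (λ u → y ∣ u + 1) (sym (suc-square∸suc j)) y∣u+1
  where
  s : ℕ
  s = y * y ∸ y
  y∣s : y ∣ s
  y∣s = n∣n*n∸n y
  y∣t+1 : y ∣ i * x + 1
  y∣t+1 = subst (λ t → y ∣ t + 1) (suc-square∸suc i) y∣x²-x+1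
  y∣lhs : y ∣ a * a * (i * x + 1) + a * s
  y∣lhs = ∣m∣n⇒∣m+n (∣n⇒∣m*n (a * a) y∣t+1) (∣n⇒∣m*n a y∣s)
  y∣s²+2s : y ∣ s * s + 2 * s
  y∣s²+2s = ∣m∣n⇒∣m+n (∣n⇒∣m*n s y∣s) (∣n⇒∣m*n 2 y∣s)
  y∣u+1 : y ∣ j * a + 1
  y∣u+1 = ∣m+n∣m⇒∣n
    (subst (y ∣_) (conjugate-identity a x s (i * x) (j * a) ax≡s+1 (+-comm (i * x) x) (+-comm (j * a) a)) y∣lhs)
    y∣s²+2s

cofactor< : ∀ {a x y} → 1 < y → y ≤ x → a * x ≡ y * y ∸ y + 1 → a < y
cofactor< {a} {x} {y@(suc m)} 1<y y≤x ax≡ = *-cancelʳ-< x a y (begin-strict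
  a * x                     ≡⟨ ax≡ ⟩
  y * y ∸ y + 1             ≡⟨ cong (_+ 1) (suc-square∸suc m) ⟩
  m * y + 1                 ≤⟨ +-monoˡ-≤ 1 (*-monoʳ-≤ m y≤x) ⟩
  m * x + 1                 <⟨ +-monoʳ-< (m * x) (<-≤-trans 1<y y≤x) ⟩
  m * x + x                 ≡⟨ +-comm (m * x) x ⟩
  y * x                     ∎)
  where open ≤-Reasoning

descent : ∀ y x → y ≤ x → x ∣ y * y ∸ y + 1 → y ∣ x * x ∸ x + 1 → y ≡ 1
descent = <-rec ForcedToOne step
  where
  ForcedToOne : ℕ → Set
  ForcedToOne y = ∀ x → y ≤ x → x ∣ y * y ∸ y + 1 → y ∣ x * x ∸ x + 1 → y ≡ 1
  step : ∀ y → (∀ {a} → a < y → ForcedToOne a) → ForcedToOne y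
  step zero             _    _ _   _                     0∣x²-x+1 =
    ⊥-elim (1+n≢0 (trans (+-comm 1 _) (0∣⇒≡0 0∣x²-x+1)))
  step (suc zero)       _    _ _   _                     _        = refl
  step y@(suc (suc _))  desc x y≤x (divides a y²-y+1≡ax) y∣x²-x+1 =
    ∣1⇒≡1 (subst (λ b → y ∣ b * b ∸ b + 1) a≡1 y∣a²-a+1)
    where
    ax≡ : a * x ≡ y * y ∸ y + 1
    ax≡ = sym y²-y+1≡ax
    a<y : a < y
    a<y = cofactor< (s≤s (s≤s z≤n)) y≤x ax≡
    y∣a²-a+1 : y ∣ a * a ∸ a + 1
    y∣a²-a+1 = conjugate-divides {a} {x} y∣x²-x+1 ax≡
    a≡1 : a ≡ 1
    a≡1 = desc a<y y (<⇒≤ a<y) y∣a²-a+1 (divides x (trans y²-y+1≡ax (*-comm a x)))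

lemma8 : (x y : ℕ) → x > 0 → y > 0 → x ≥ y → x ∣ (y * y ∸ y + 1) → y ∣ (x * x ∸ x + 1) → (x ≡ 1) × (y ≡ 1)
-- The positivity hypotheses are redundant: 0 divides no x² − x + 1.
lemma8 x y _ _ x≥y x∣y²-y+1 y∣x²-x+1 = ∣1⇒≡1 (subst (λ b → x ∣ b * b ∸ b + 1) y≡1 x∣y²-y+1) , y≡1
  where
  y≡1 : y ≡ 1
  y≡1 = descent y x x≥y x∣y²-y+1 y∣x²-x+1
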